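{- Let $n\ge1$ and let $p/q\in\mathcal{K}$ be a rational number in lowest terms with $3^{n-1}<q\le 3^n$. Then $\mathcal{L}(p/q)\le n$ and $\mathcal{L}(p/q)+\mathcal{P}(p/q)\ge n$.
   Context: $\mathcal{K}$ is the triadic Cantor set; every point of $\mathcal{K}$ has a unique 3-adic expansion with digits in $\{0,2\}$. For a rational $p/q\in\mathcal{K}$ with digit sequence $(\epsilon_i)$, the prelength $\mathcal{L}(p/q)$ is the smallest integer $\ell\ge0$ such that $(\epsilon_i)_{i>\ell}$ is purely periodic, and the period $\mathcal{P}(p/q)$ is the smallest period of $(\epsilon_i)_{i>\ell}$. -}

module Defs where

open import Data.Nat using (ℕ; zero; suc; _+_; _*_; _^_; _≤_; _<_)
open import Data.Bool using (Bool; true; false)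
open import Data.Product using (_×_; ∃-syntax)
open import Relation.Binary.PropositionalEquality using (_≡_)
open import Relation.Nullary using (¬_)

-- A {0,2}-digit sequence: ε i is the (i+1)-th ternary digit
-- (true ↦ 2, false ↦ 0), i.e. ε 0 = ε₁, ε 1 = ε₂, ...
DigitSeq : Set
DigitSeq = ℕ → Bool

digit : Bool → ℕ
digit true  = 2
digit false = 0

-- partial : ε N = Σ_{i=1}^{N} ε_i 3^{N-i}, i.e. 3^N times the N-th partial sum
partial : DigitSeq → ℕ → ℕ
partial ε zero    = 0
partial ε (suc N) = 3 * partial ε N + digit (ε N)

-- p/q = Σ_{i≥1} ε_i 3^{-i}  (with q > 0).  Since the tail Σ_{i>N} ε_i 3^{-i}
-- lies in [0, 3^{-N}], this is equivalent to: for every N,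
--   S_N ≤ p/q ≤ S_N + 3^{-N}, where S_N is the N-th partial sum,
-- written here after clearing denominators.
Expansion : ℕ → ℕ → DigitSeq → Set
Expansion p q ε = ∀ N → (partial ε N * q ≤ p * 3 ^ N) × (p * 3 ^ N ≤ (partial ε N + 1) * q)

PeriodicFrom : DigitSeq → ℕ → ℕ → Set
PeriodicFrom ε ℓ per = (1 ≤ per) × (∀ k → ε (ℓ + k + per) ≡ ε (ℓ + k))

IsPrelength : DigitSeq → ℕ → Set
IsPrelength ε ℓ = (∃[ per ] PeriodicFrom ε ℓ per)
                × (∀ ℓ′ → ℓ′ < ℓ → ¬ (∃[ per ] PeriodicFrom ε ℓ′ per))

IsPeriod : DigitSeq → ℕ → ℕ → Set
IsPeriod ε ℓ per = PeriodicFrom ε ℓ per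
                 × (∀ per′ → 1 ≤ per′ → per′ < per → ¬ PeriodicFrom ε ℓ per′)

{-# OPTIONS --safe #-}
module Submission where

open import Defs
open import Data.Nat using (ℕ; _+_; _^_; _≤_; _<_; _∸_)
open import Data.Nat.Coprimality using (Coprime)
open import Data.Product using (_×_; ∃-syntax)

open import Data.Nat using (zero; suc; _*_; z≤n; s≤s; s≤s⁻¹; NonZero; >-nonZero; >-nonZero⁻¹; _%_; _≟_; _≤?_)
open import Data.Nat.Properties
open import Data.Nat.Divisibility
open import Data.Nat.DivMod using ([m+kn]%n≡m%n; m<n⇒m%n≡m; n%n≡0)
open import Data.Nat.Primality using (Prime; prime?; prime⇒irreducible)
open import Data.Nat.Tactic.RingSolver using (solve-∀)
import Data.Nat.Coprimality as Coprime
open import Data.Bool using (true; false)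
open import Data.Fin using (toℕ; fromℕ<)
open import Data.Fin.Properties using (pigeonhole; toℕ-fromℕ<)
open import Data.Product using (_,_; proj₁; proj₂)
open import Data.Sum using (_⊎_; inj₁; inj₂)
open import Relation.Nullary using (¬_; Dec; yes; no; contradiction)
open import Relation.Nullary.Decidable using (from-yes; map′; _×-dec_)
open import Relation.Unary using (Decidable)
open import Relation.Binary.PropositionalEquality

-- Scale the remainders of the expansion: r N = 3^N p − q (ε₁ … ε_N)₃ ∈ [0, q].  Then
-- r (N+1) = 3 r N − ε_{N+1} q and the digit ε_{N+1} is determined by r N, so two tails of ε
-- agree exactly when the corresponding remainders agree.  As gcd(p, q) = 1, the tail after ℓ
-- therefore has period P iff q ∣ 3^ℓ (3^P − 1); in the converse direction the congruence
-- 0 ≡ q mod q is harmless because 0 and q are fixed points of the remainder map.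
-- The remainders take at most q + 1 values, so some tail is periodic, with period D say.
-- The power of 3 dividing q is at most q ≤ 3^n, hence already q ∣ 3^n (3^D − 1): the tail
-- after n is periodic and the prelength is at most n.  Conversely the prelength ℓ and the
-- period P satisfy 3^(n−1) < q ≤ 3^ℓ (3^P − 1) < 3^(ℓ+P), whence ℓ + P ≥ n.

Minimal : (ℕ → Set) → ℕ → Set
Minimal P m = P m × (∀ k → k < m → ¬ P k)

module _ {P : ℕ → Set} (P? : Decidable P) where

  minimal-or-none : ∀ n → (∃[ m ] (m < n × Minimal P m)) ⊎ (∀ k → k < n → ¬ P k)
  minimal-or-none zero = inj₂ (λ _ ())
  minimal-or-none (suc n) with minimal-or-none n
  ... | inj₁ (m , m<n , min) = inj₁ (m , m<n⇒m<1+n m<n , min)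
  ... | inj₂ none with P? n
  ...   | yes Pn = inj₁ (n , n<1+n n , Pn , none)
  ...   | no ¬Pn = inj₂ none′
    where
    none′ : ∀ k → k < suc n → ¬ P k
    none′ k k<1+n with m<1+n⇒m<n∨m≡n k<1+n
    ... | inj₁ k<n  = none k k<n
    ... | inj₂ refl = ¬Pn

  minimal-below : ∀ n → P n → ∃[ m ] (m ≤ n × Minimal P m)
  minimal-below n Pn with minimal-or-none (suc n)
  ... | inj₁ (m , m<1+n , min) = m , s≤s⁻¹ m<1+n , min
  ... | inj₂ none              = contradiction Pn (none n ≤-refl)

n<3^n : ∀ n → n < 3 ^ n
n<3^n zero    = s≤s z≤n
n<3^n (suc n) = ≤-trans (s≤s (n<3^n n))
  (subst (suc (3 ^ n) ≤_) (*-comm (3 ^ n) 3) (m<m*n (3 ^ n) 3 {{m^n≢0 3 n}} (s≤s (s≤s z≤n))))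

m*n≰n : ∀ m n .{{_ : NonZero n}} → 1 < m → ¬ m * n ≤ n
m*n≰n m n 1<m = <⇒≱ (subst (n <_) (*-comm n m) (m<m*n n m 1<m))

m^n<m^o⇒n<o : ∀ m .{{_ : NonZero m}} {n o} → m ^ n < m ^ o → n < o
m^n<m^o⇒n<o m m^n<m^o = ≰⇒> (λ o≤n → <⇒≱ m^n<m^o (^-monoʳ-≤ m o≤n))

m^[n+o]≡m^n+m^n*[m^o∸1] : ∀ m .{{_ : NonZero m}} n o → m ^ (n + o) ≡ m ^ n + m ^ n * (m ^ o ∸ 1)
m^[n+o]≡m^n+m^n*[m^o∸1] m n o = begin
  m ^ (n + o)                    ≡⟨ ^-distribˡ-+-* m n o ⟩
  m ^ n * m ^ o                  ≡⟨ cong (m ^ n *_) (m+[n∸m]≡n (m^n>0 m o)) ⟨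
  m ^ n * (1 + (m ^ o ∸ 1))      ≡⟨ *-distribˡ-+ (m ^ n) 1 (m ^ o ∸ 1) ⟩
  m ^ n * 1 + m ^ n * (m ^ o ∸ 1) ≡⟨ cong (_+ m ^ n * (m ^ o ∸ 1)) (*-identityʳ (m ^ n)) ⟩
  m ^ n + m ^ n * (m ^ o ∸ 1)    ∎
  where open ≡-Reasoning

m+kn≡o+ln⇒m≡o : ∀ {m o k l n} .{{_ : NonZero n}} →
                0 < o → o < n → m ≤ n → m + k * n ≡ o + l * n → m ≡ o
m+kn≡o+ln⇒m≡o {m} {o} {k} {l} {n} 0<o o<n m≤n eq = trans (sym (m<n⇒m%n≡m m<n)) m%n≡o
  where
  m%n≡o : m % n ≡ o
  m%n≡o = begin
    m % n           ≡⟨ sym ([m+kn]%n≡m%n m k n) ⟩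
    (m + k * n) % n ≡⟨ cong (_% n) eq ⟩
    (o + l * n) % n ≡⟨ [m+kn]%n≡m%n o l n ⟩
    o % n           ≡⟨ m<n⇒m%n≡m o<n ⟩
    o               ∎
    where open ≡-Reasoning
  m<n : m < n
  m<n = ≤∧≢⇒< m≤n (λ { refl → <⇒≢ 0<o (trans (sym (n%n≡0 n)) m%n≡o) })

prime∤⇒coprime : ∀ {p m} → Prime p → ¬ p ∣ m → Coprime m p
prime∤⇒coprime p-prime p∤m (d∣m , d∣p) with prime⇒irreducible p-prime d∣p
... | inj₁ d≡1  = d≡1
... | inj₂ refl = contradiction d∣m p∤m

coprime-^-divisor : ∀ {d a x} m → Coprime d a → d ∣ a ^ m * x → d ∣ x
coprime-^-divisor {x = x} zero    _   d∣x = subst (_ ∣_) (*-identityˡ x) d∣x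
coprime-^-divisor {d} {a} {x} (suc m) d⊥a d∣ =
  coprime-^-divisor m d⊥a (Coprime.coprime-divisor d⊥a (subst (d ∣_) (*-assoc a (a ^ m) x) d∣))

∣3^m*x⇒∣3^k*x : ∀ k {m x q} → 1 ≤ q → q ≤ 3 ^ k → q ∣ 3 ^ m * x → q ∣ 3 ^ k * x
∣3^m*x⇒∣3^k*x zero {x = x} 1≤q q≤1 _ rewrite ≤-antisym q≤1 1≤q = 1∣ (1 * x)
∣3^m*x⇒∣3^k*x (suc k) {m} {x} {q} 1≤q q≤3^k q∣ with 3 ∣? q
... | no 3∤q = ∣n⇒∣m*n (3 ^ suc k) (coprime-^-divisor m (prime∤⇒coprime (from-yes (prime? 3)) 3∤q) q∣)
... | yes (divides t refl) = subst (t * 3 ∣_) (trans (*-comm (3 ^ k * x) 3) (sym (*-assoc 3 (3 ^ k) x)))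
                               (*-pres-∣ t∣3^k*x (∣-refl {3}))
  where
  t∣3^k*x : t ∣ 3 ^ k * x
  t∣3^k*x = ∣3^m*x⇒∣3^k*x k {m}
    (n≢0⇒n>0 (λ { refl → contradiction 1≤q λ () }))
    (*-cancelʳ-≤ t (3 ^ k) 3 (subst (t * 3 ≤_) (*-comm 3 (3 ^ k)) q≤3^k))
    (∣-trans (divides 3 (*-comm t 3)) q∣)

∣3^ℓ*[3^P∸1]⇒<3^[ℓ+P] : ∀ ℓ {P q} → 0 < P → q ∣ 3 ^ ℓ * (3 ^ P ∸ 1) → q < 3 ^ (ℓ + P)
∣3^ℓ*[3^P∸1]⇒<3^[ℓ+P] ℓ {P} {q} 0<P q∣ = begin-strict
  q                    ≤⟨ ∣⇒≤ {{>-nonZero (*-mono-≤ (m^n>0 3 ℓ) (m<n⇒0<n∸m 1<3^P))}} q∣ ⟩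
  3 ^ ℓ * (3 ^ P ∸ 1)  <⟨ *-monoʳ-< (3 ^ ℓ) {{m^n≢0 3 ℓ}} (∸-monoʳ-< {3 ^ P} (s≤s z≤n) (<⇒≤ 1<3^P)) ⟩
  3 ^ ℓ * 3 ^ P        ≡⟨ ^-distribˡ-+-* 3 ℓ P ⟨
  3 ^ (ℓ + P)          ∎
  where
  open ≤-Reasoning
  1<3^P : 1 < 3 ^ P
  1<3^P = ^-monoʳ-< 3 (s≤s (s≤s z≤n)) 0<P

-- Opaque: unfolding the pigeonhole witness makes checking the uses below very slow.
opaque
  bounded⇒repeats : ∀ (x : ℕ → ℕ) {b} → (∀ N → x N ≤ b) → ∃[ i ] ∃[ d ] x (i + suc d) ≡ x i
  bounded⇒repeats x {b} x≤b with pigeonhole (n<1+n (suc b)) (λ k → fromℕ< (s≤s (x≤b (toℕ k))))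
  ... | i , j , i<j , fi≡fj with m≤n⇒∃[o]m+o≡n i<j
  ...   | d , 1+i+d≡j = toℕ i , d , (begin
    x (toℕ i + suc d)              ≡⟨ cong x (trans (+-suc (toℕ i) d) 1+i+d≡j) ⟩
    x (toℕ j)                      ≡⟨ toℕ-fromℕ< _ ⟨
    toℕ (fromℕ< (s≤s (x≤b (toℕ j)))) ≡⟨ cong toℕ fi≡fj ⟨
    toℕ (fromℕ< (s≤s (x≤b (toℕ i)))) ≡⟨ toℕ-fromℕ< _ ⟩
    x (toℕ i)                      ∎)
    where open ≡-Reasoning

module _ {ε : DigitSeq} where

  periodic-iterate : ∀ {ℓ P} → PeriodicFrom ε ℓ P → ∀ m j → ε (ℓ + j + m * P) ≡ ε (ℓ + j)
  periodic-iterate {ℓ} _ zero j = cong ε (+-identityʳ (ℓ + j))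
  periodic-iterate {ℓ} {P} ℓ-periodic@(_ , ε-per) (suc m) j = begin
    ε (ℓ + j + suc m * P)    ≡⟨ cong ε (reassoc ℓ j m P) ⟩
    ε (ℓ + (j + m * P) + P)  ≡⟨ ε-per (j + m * P) ⟩
    ε (ℓ + (j + m * P))      ≡⟨ cong ε (+-assoc ℓ j (m * P)) ⟨
    ε (ℓ + j + m * P)        ≡⟨ periodic-iterate ℓ-periodic m j ⟩
    ε (ℓ + j)                ∎
    where
    open ≡-Reasoning
    reassoc : ∀ ℓ j m P → ℓ + j + suc m * P ≡ ℓ + (j + m * P) + P
    reassoc = solve-∀

  -- Moving i periods P along the tail after ℓ lands past i, where D is a period.
  periodic-transfer : ∀ {i D ℓ P} → PeriodicFrom ε i D → PeriodicFrom ε ℓ P → PeriodicFrom ε ℓ D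
  periodic-transfer {P = zero} _ (() , _)
  periodic-transfer {i} {D} {ℓ} {suc P} (0<D , ε-per) ℓ-periodic = 0<D , λ k → begin
    ε (ℓ + k + D)                  ≡⟨ cong ε (+-assoc ℓ k D) ⟩
    ε (ℓ + (k + D))                ≡⟨ periodic-iterate ℓ-periodic i (k + D) ⟨
    ε (ℓ + (k + D) + i * suc P)    ≡⟨ cong ε (reassoc₁ ℓ k D i P) ⟩
    ε (i + (ℓ + k + i * P) + D)    ≡⟨ ε-per (ℓ + k + i * P) ⟩
    ε (i + (ℓ + k + i * P))        ≡⟨ cong ε (reassoc₂ ℓ k i P) ⟩
    ε (ℓ + k + i * suc P)          ≡⟨ periodic-iterate ℓ-periodic i k ⟩
    ε (ℓ + k)                      ∎
    where
    open ≡-Reasoning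
    reassoc₁ : ∀ ℓ k D i P → ℓ + (k + D) + i * suc P ≡ i + (ℓ + k + i * P) + D
    reassoc₁ = solve-∀
    reassoc₂ : ∀ ℓ k i P → i + (ℓ + k + i * P) ≡ ℓ + k + i * suc P
    reassoc₂ = solve-∀

  module _ (periodic? : ∀ ℓ P → Dec (PeriodicFrom ε ℓ P)) where

    periodic⇒period : ∀ {ℓ P} → PeriodicFrom ε ℓ P → ∃[ per ] IsPeriod ε ℓ per
    periodic⇒period {ℓ} {P} ℓ-periodic with minimal-below (periodic? ℓ) P ℓ-periodic
    ... | per , _ , per-periodic , below = per , per-periodic , λ per′ _ per′<per → below per′ per′<per

    periodic⇒prelength≤ : ∀ {n D} → PeriodicFrom ε n D → ∃[ ℓ ] (ℓ ≤ n × IsPrelength ε ℓ)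
    periodic⇒prelength≤ {n} {D} n-periodic with minimal-below (λ ℓ → periodic? ℓ D) n n-periodic
    ... | ℓ , ℓ≤n , ℓ-periodic , below =
      ℓ , ℓ≤n , (D , ℓ-periodic) ,
      λ ℓ′ ℓ′<ℓ (_ , ℓ′-periodic) → below ℓ′ ℓ′<ℓ (periodic-transfer n-periodic ℓ′-periodic)

-- r N / q is the value Σ_{i>N} ε_i 3^{N-i} of the tail after N digits, which lies in [0, 1].
module Remainder (p q : ℕ) .{{_ : NonZero q}} (ε : DigitSeq) (expansion : Expansion p q ε) where

  opaque
    r : ℕ → ℕ
    r N = p * 3 ^ N ∸ partial ε N * q

    r+partial*q≡p*3^N : ∀ N → r N + partial ε N * q ≡ p * 3 ^ N
    r+partial*q≡p*3^N N = m∸n+n≡m (proj₁ (expansion N))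

    r≤q : ∀ N → r N ≤ q
    r≤q N = m≤n+o⇒m∸n≤o (p * 3 ^ N) (partial ε N * q)
      (subst (p * 3 ^ N ≤_) (distrib (partial ε N) q) (proj₂ (expansion N)))
      where
      distrib : ∀ s q → (s + 1) * q ≡ s * q + q
      distrib = solve-∀

  r-suc : ∀ N → r (suc N) + digit (ε N) * q ≡ 3 * r N
  r-suc N = +-cancelʳ-≡ (3 * (s * q)) _ _ (begin
    r (suc N) + d * q + 3 * (s * q)  ≡⟨ regroup (r (suc N)) d q s ⟩
    r (suc N) + (3 * s + d) * q      ≡⟨ r+partial*q≡p*3^N (suc N) ⟩
    p * (3 * 3 ^ N)                  ≡⟨ *-assoc p 3 (3 ^ N) ⟨
    p * 3 * 3 ^ N                    ≡⟨ cong (_* 3 ^ N) (*-comm p 3) ⟩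
    3 * p * 3 ^ N                    ≡⟨ *-assoc 3 p (3 ^ N) ⟩
    3 * (p * 3 ^ N)                  ≡⟨ cong (3 *_) (r+partial*q≡p*3^N N) ⟨
    3 * (r N + s * q)                ≡⟨ *-distribˡ-+ 3 (r N) (s * q) ⟩
    3 * r N + 3 * (s * q)            ∎)
    where
    open ≡-Reasoning
    s = partial ε N
    d = digit (ε N)
    regroup : ∀ a d q s → a + d * q + 3 * (s * q) ≡ a + (3 * s + d) * q
    regroup = solve-∀

  r-suc-at : ∀ {N b} → ε N ≡ b → r (suc N) + digit b * q ≡ 3 * r N
  r-suc-at {N} refl = r-suc N

  ε≡true⇒2q≤3r : ∀ {N} → ε N ≡ true → 2 * q ≤ 3 * r N
  ε≡true⇒2q≤3r {N} εN≡2 = ≤-trans (m≤n+m (2 * q) (r (suc N))) (≤-reflexive (r-suc-at εN≡2))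

  ε≡false⇒3r≤q : ∀ {N} → ε N ≡ false → 3 * r N ≤ q
  ε≡false⇒3r≤q {N} εN≡0 = begin
    3 * r N            ≡⟨ r-suc-at εN≡0 ⟨
    r (suc N) + 0 * q  ≡⟨ +-identityʳ (r (suc N)) ⟩
    r (suc N)          ≤⟨ r≤q (suc N) ⟩
    q                  ∎
    where open ≤-Reasoning

  ε≡true∧ε≡false⇒r≢ : ∀ {a b} → ε a ≡ true → ε b ≡ false → r a ≢ r b
  ε≡true∧ε≡false⇒r≢ {a} {b} εa≡2 εb≡0 ra≡rb = m*n≰n 2 q (s≤s (s≤s z≤n)) (begin
    2 * q    ≤⟨ ε≡true⇒2q≤3r εa≡2 ⟩
    3 * r a  ≡⟨ cong (3 *_) ra≡rb ⟩
    3 * r b  ≤⟨ ε≡false⇒3r≤q εb≡0 ⟩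
    q        ∎)
    where open ≤-Reasoning

  r≡⇒ε≡ : ∀ {a b} → r a ≡ r b → ε a ≡ ε b
  r≡⇒ε≡ {a} {b} ra≡rb with ε a in εa | ε b in εb
  ... | true  | true  = refl
  ... | false | false = refl
  ... | true  | false = contradiction ra≡rb (ε≡true∧ε≡false⇒r≢ εa εb)
  ... | false | true  = contradiction (sym ra≡rb) (ε≡true∧ε≡false⇒r≢ εb εa)

  r≡⇒r-suc≡ : ∀ {a b} → r a ≡ r b → r (suc a) ≡ r (suc b)
  r≡⇒r-suc≡ {a} {b} ra≡rb = +-cancelʳ-≡ (digit (ε a) * q) _ _ (begin
    r (suc a) + digit (ε a) * q  ≡⟨ r-suc a ⟩
    3 * r a                      ≡⟨ cong (3 *_) ra≡rb ⟩
    3 * r b                      ≡⟨ r-suc-at (sym (r≡⇒ε≡ ra≡rb)) ⟨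
    r (suc b) + digit (ε a) * q  ∎)
    where open ≡-Reasoning

  r≡⇒r-shift≡ : ∀ {a b} → r a ≡ r b → ∀ k → r (k + a) ≡ r (k + b)
  r≡⇒r-shift≡ ra≡rb zero    = ra≡rb
  r≡⇒r-shift≡ ra≡rb (suc k) = r≡⇒r-suc≡ (r≡⇒r-shift≡ ra≡rb k)

  r-fixed : ∀ {a} → r (suc a) ≡ r a → ∀ k → r (a + k) ≡ r a
  r-fixed {a} fixed zero    = cong r (+-identityʳ a)
  r-fixed {a} fixed (suc k) = trans (cong r (+-suc a k)) (trans (r≡⇒r-suc≡ (r-fixed fixed k)) fixed)

  r≡0⇒r-suc≡0 : ∀ {N} → r N ≡ 0 → r (suc N) ≡ 0
  r≡0⇒r-suc≡0 {N} rN≡0 = m+n≡0⇒m≡0 (r (suc N)) (trans (r-suc N) (cong (3 *_) rN≡0))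

  r≡q⇒r-suc≡q : ∀ {N} → r N ≡ q → r (suc N) ≡ q
  r≡q⇒r-suc≡q {N} rN≡q with ε N in εN
  ... | true  = +-cancelʳ-≡ (2 * q) _ _ (trans (r-suc-at εN) (cong (3 *_) rN≡q))
  ... | false = contradiction (subst (λ x → 3 * x ≤ q) rN≡q (ε≡false⇒3r≤q εN))
                              (m*n≰n 3 q (s≤s (s≤s z≤n)))

  r-gap-grows : ∀ {a b c} → (∀ k → ε (k + a) ≡ ε (k + b)) → r a + c ≡ r b →
                ∀ k → r (k + a) + 3 ^ k * c ≡ r (k + b)
  r-gap-grows {c = c} _ gap zero = trans (cong (_ +_) (*-identityˡ c)) gap
  r-gap-grows {a} {b} {c} same gap (suc k) = +-cancelʳ-≡ (digit (ε (k + a)) * q) _ _ (begin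
    r (suc k + a) + 3 ^ suc k * c + d * q    ≡⟨ regroup (r (suc k + a)) (3 ^ k) c (d * q) ⟩
    r (suc k + a) + d * q + 3 * (3 ^ k * c)  ≡⟨ cong (_+ 3 * (3 ^ k * c)) (r-suc (k + a)) ⟩
    3 * r (k + a) + 3 * (3 ^ k * c)          ≡⟨ *-distribˡ-+ 3 (r (k + a)) (3 ^ k * c) ⟨
    3 * (r (k + a) + 3 ^ k * c)              ≡⟨ cong (3 *_) (r-gap-grows same gap k) ⟩
    3 * r (k + b)                            ≡⟨ r-suc-at (sym (same k)) ⟨
    r (suc k + b) + d * q                    ∎)
    where
    open ≡-Reasoning
    d = digit (ε (k + a))
    regroup : ∀ x y c z → x + 3 * y * c + z ≡ x + z + 3 * (y * c)
    regroup = solve-∀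

  same-tail∧r≤⇒r≡ : ∀ {a b} → (∀ k → ε (k + a) ≡ ε (k + b)) → r a ≤ r b → r a ≡ r b
  same-tail∧r≤⇒r≡ {a} {b} same ra≤rb with m≤n⇒∃[o]m+o≡n ra≤rb
  ... | zero  , gap = trans (sym (+-identityʳ (r a))) gap
  ... | suc c , gap = contradiction (begin
    3 ^ q                        ≤⟨ m≤m*n (3 ^ q) (suc c) ⟩
    3 ^ q * suc c                ≤⟨ m≤n+m (3 ^ q * suc c) (r (q + a)) ⟩
    r (q + a) + 3 ^ q * suc c    ≡⟨ r-gap-grows same gap q ⟩
    r (q + b)                    ≤⟨ r≤q (q + b) ⟩
    q                            ∎) (<⇒≱ (n<3^n q))
    where open ≤-Reasoning

  same-tail⇒r≡ : ∀ {a b} → (∀ k → ε (k + a) ≡ ε (k + b)) → r a ≡ r b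
  same-tail⇒r≡ {a} {b} same with ≤-total (r a) (r b)
  ... | inj₁ ra≤rb = same-tail∧r≤⇒r≡ same ra≤rb
  ... | inj₂ rb≤ra = sym (same-tail∧r≤⇒r≡ (λ k → sym (same k)) rb≤ra)

  periodic⇒r≡ : ∀ {ℓ P} → PeriodicFrom ε ℓ P → r (ℓ + P) ≡ r ℓ
  periodic⇒r≡ {ℓ} {P} (_ , ε-per) = same-tail⇒r≡ λ k → begin
    ε (k + (ℓ + P))  ≡⟨ cong ε (reindex k ℓ P) ⟩
    ε (ℓ + k + P)    ≡⟨ ε-per k ⟩
    ε (ℓ + k)        ≡⟨ cong ε (+-comm ℓ k) ⟩
    ε (k + ℓ)        ∎
    where
    open ≡-Reasoning
    reindex : ∀ k ℓ P → k + (ℓ + P) ≡ ℓ + k + P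
    reindex = solve-∀

  r≡⇒periodic : ∀ {ℓ P} → 0 < P → r (ℓ + P) ≡ r ℓ → PeriodicFrom ε ℓ P
  r≡⇒periodic {ℓ} {P} 0<P r≡ = 0<P , λ k → begin
    ε (ℓ + k + P)    ≡⟨ cong ε (reindex ℓ k P) ⟩
    ε (k + (ℓ + P))  ≡⟨ r≡⇒ε≡ (r≡⇒r-shift≡ r≡ k) ⟩
    ε (k + ℓ)        ≡⟨ cong ε (+-comm k ℓ) ⟩
    ε (ℓ + k)        ∎
    where
    open ≡-Reasoning
    reindex : ∀ ℓ k P → ℓ + k + P ≡ k + (ℓ + P)
    reindex = solve-∀

  periodic? : ∀ ℓ P → Dec (PeriodicFrom ε ℓ P)
  periodic? ℓ P = map′ (λ (0<P , r≡) → r≡⇒periodic 0<P r≡) (λ per → proj₁ per , periodic⇒r≡ per)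
                       (1 ≤? P ×-dec r (ℓ + P) ≟ r ℓ)

  eventually-periodic : ∃[ i ] ∃[ D ] PeriodicFrom ε i D
  eventually-periodic with bounded⇒repeats r r≤q
  ... | i , d , repeat = i , suc d , r≡⇒periodic (s≤s z≤n) repeat

  r-ahead : ∀ ℓ P →
            r (ℓ + P) + partial ε (ℓ + P) * q ≡ r ℓ + partial ε ℓ * q + p * (3 ^ ℓ * (3 ^ P ∸ 1))
  r-ahead ℓ P = begin
    r (ℓ + P) + partial ε (ℓ + P) * q        ≡⟨ r+partial*q≡p*3^N (ℓ + P) ⟩
    p * 3 ^ (ℓ + P)                          ≡⟨ cong (p *_) (m^[n+o]≡m^n+m^n*[m^o∸1] 3 ℓ P) ⟩
    p * (3 ^ ℓ + 3 ^ ℓ * (3 ^ P ∸ 1))        ≡⟨ *-distribˡ-+ p (3 ^ ℓ) (3 ^ ℓ * (3 ^ P ∸ 1)) ⟩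
    p * 3 ^ ℓ + p * (3 ^ ℓ * (3 ^ P ∸ 1))    ≡⟨ cong (_+ p * (3 ^ ℓ * (3 ^ P ∸ 1))) (r+partial*q≡p*3^N ℓ) ⟨
    r ℓ + partial ε ℓ * q + p * (3 ^ ℓ * (3 ^ P ∸ 1)) ∎
    where open ≡-Reasoning

  periodic⇒q∣ : Coprime p q → ∀ {ℓ P} → PeriodicFrom ε ℓ P → q ∣ 3 ^ ℓ * (3 ^ P ∸ 1)
  periodic⇒q∣ p⊥q {ℓ} {P} ℓ-periodic =
    Coprime.coprime-divisor (Coprime.sym p⊥q)
      (∣m+n∣m⇒∣n (divides (partial ε (ℓ + P)) multiple) (n∣m*n (partial ε ℓ)))
    where
    multiple : partial ε ℓ * q + p * (3 ^ ℓ * (3 ^ P ∸ 1)) ≡ partial ε (ℓ + P) * q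
    multiple = +-cancelˡ-≡ (r ℓ) _ _ (begin
      r ℓ + (partial ε ℓ * q + p * (3 ^ ℓ * (3 ^ P ∸ 1)))  ≡⟨ +-assoc (r ℓ) _ _ ⟨
      r ℓ + partial ε ℓ * q + p * (3 ^ ℓ * (3 ^ P ∸ 1))    ≡⟨ r-ahead ℓ P ⟨
      r (ℓ + P) + partial ε (ℓ + P) * q                    ≡⟨ cong (_+ partial ε (ℓ + P) * q) (periodic⇒r≡ ℓ-periodic) ⟩
      r ℓ + partial ε (ℓ + P) * q                          ∎)
      where open ≡-Reasoning

  -- Remainders congruent mod q agree, except that 0 and q are congruent; both are fixed points.
  r-ahead-congruent⇒r≡ : ∀ {ℓ P x y} → r (ℓ + P) + x * q ≡ r ℓ + y * q → r (ℓ + P) ≡ r ℓ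
  r-ahead-congruent⇒r≡ {ℓ} {P} {x} {y} congruent with r ℓ ≟ 0 | r ℓ ≟ q
  ... | yes rℓ≡0 | _        = r-fixed (trans (r≡0⇒r-suc≡0 rℓ≡0) (sym rℓ≡0)) P
  ... | no _     | yes rℓ≡q = r-fixed (trans (r≡q⇒r-suc≡q rℓ≡q) (sym rℓ≡q)) P
  ... | no rℓ≢0  | no rℓ≢q  =
    m+kn≡o+ln⇒m≡o {k = x} {l = y} (n≢0⇒n>0 rℓ≢0) (≤∧≢⇒< (r≤q ℓ) rℓ≢q) (r≤q (ℓ + P)) congruent

  q∣⇒periodic : ∀ {ℓ P} → 0 < P → q ∣ 3 ^ ℓ * (3 ^ P ∸ 1) → PeriodicFrom ε ℓ P
  q∣⇒periodic {ℓ} {P} 0<P q∣ with ∣n⇒∣m*n p q∣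
  ... | divides t pZ≡tq =
    r≡⇒periodic 0<P (r-ahead-congruent⇒r≡ {x = partial ε (ℓ + P)} {y = partial ε ℓ + t} (begin
    r (ℓ + P) + partial ε (ℓ + P) * q                  ≡⟨ r-ahead ℓ P ⟩
    r ℓ + partial ε ℓ * q + p * (3 ^ ℓ * (3 ^ P ∸ 1))  ≡⟨ cong (r ℓ + partial ε ℓ * q +_) pZ≡tq ⟩
    r ℓ + partial ε ℓ * q + t * q                      ≡⟨ +-assoc (r ℓ) _ _ ⟩
    r ℓ + (partial ε ℓ * q + t * q)                    ≡⟨ cong (r ℓ +_) (*-distribʳ-+ q (partial ε ℓ) t) ⟨
    r ℓ + (partial ε ℓ + t) * q                        ∎))
    where open ≡-Reasoning

  periodic-from : Coprime p q → ∀ n → q ≤ 3 ^ n → ∃[ D ] PeriodicFrom ε n D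
  periodic-from p⊥q n q≤3^n with eventually-periodic
  ... | i , D , i-periodic@(0<D , _) =
    D , q∣⇒periodic 0<D (∣3^m*x⇒∣3^k*x n {i} (>-nonZero⁻¹ q) q≤3^n (periodic⇒q∣ p⊥q i-periodic))

  periodic⇒q<3^[ℓ+P] : Coprime p q → ∀ {ℓ P} → PeriodicFrom ε ℓ P → q < 3 ^ (ℓ + P)
  periodic⇒q<3^[ℓ+P] p⊥q {ℓ} ℓ-periodic@(0<P , _) =
    ∣3^ℓ*[3^P∸1]⇒<3^[ℓ+P] ℓ 0<P (periodic⇒q∣ p⊥q ℓ-periodic)

  prelength≤∧period : Coprime p q → ∀ n → q ≤ 3 ^ n →
                      ∃[ ℓ ] ∃[ per ] (IsPrelength ε ℓ × IsPeriod ε ℓ per × ℓ ≤ n × q < 3 ^ (ℓ + per))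
  prelength≤∧period p⊥q n q≤3^n =
    let (_ , n-periodic)         = periodic-from p⊥q n q≤3^n
        (ℓ , ℓ≤n , prelength)    = periodic⇒prelength≤ {ε} periodic? n-periodic
        ((_ , ℓ-periodic) , _)   = prelength
        (per , period)           = periodic⇒period {ε} periodic? ℓ-periodic
    in ℓ , per , prelength , period , ℓ≤n , periodic⇒q<3^[ℓ+P] p⊥q {ℓ} (proj₁ period)

lemma6p2 : (n p q : ℕ) → 1 ≤ n → Coprime p q → 3 ^ (n ∸ 1) < q → q ≤ 3 ^ n →
    (ε : DigitSeq) → Expansion p q ε →
    ∃[ ℓ ] ∃[ per ] (IsPrelength ε ℓ × IsPeriod ε ℓ per × ℓ ≤ n × n ≤ ℓ + per)
lemma6p2 n@(suc m) p q _ p⊥q 3^m<q q≤3^n ε expansion =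
  let (ℓ , per , prelength , period , ℓ≤n , q<3^[ℓ+per]) =
        Remainder.prelength≤∧period p q {{>-nonZero (≤-<-trans z≤n 3^m<q)}} ε expansion p⊥q n q≤3^n
  in ℓ , per , prelength , period , ℓ≤n , m^n<m^o⇒n<o 3 {m} {ℓ + per} (<-trans 3^m<q q<3^[ℓ+per])
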